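{- Let $Y$ be a finite set, $\mathbb{M}$ a complete MV-chain, $f:\mathbb{M}^Y\to\mathbb{M}^Y$ a function and $H_{\min}$ a min-decomposition of $f$ such that every $h\in H_{\min}(y)$, for every $y\in Y$, is non-expansive. Then $f$ is non-expansive, and for every $a\in\mathbb{M}^Y$ and every $Y'\subseteq[Y]^a$, $$f^a_\#(Y')=\{y\in[Y]^{f(a)}\mid \exists h\in H_{\min}(y)\ \big(h(a)=\min_{h'\in H_{\min}(y)}h'(a)\ \wedge\ h^a_\#(Y')\neq\emptyset\big)\}.$$
   Context: An MV-algebra is a tuple $(\mathbb{M},\oplus,0,\overline{(\cdot)})$ where $(\mathbb{M},\oplus,0)$ is a commutative monoid and $\overline{(\cdot)}:\mathbb{M}\to\mathbb{M}$ satisfies, for all $x,y$: $\overline{\overline{x}}=x$, $x\oplus\overline{0}=\overline{0}$, and $\overline{(\overline{x}\oplus y)}\oplus y=\overline{(\overline{y}\oplus x)}\oplus x$. Write $x\ominus y=\overline{\overline{x}\oplus y}$. The natural order is $x\sqsubseteq y$ iff $x\oplus z=y$ for some $z\in\mathbb{M}$. An MV-chain is an MV-algebra whose natural order is total; it is complete if it is a complete lattice under the natural order. $\mathbb{M}^Y$ carries the pointwise order and pointwise $\ominus$. For finite $Y$ and $a\in\mathbb{M}^Y$, $\|a\|=\max_{y\in Y}a(y)$. A function $g:\mathbb{M}^Y\to\mathbb{M}^Z$ ($Y,Z$ finite) is non-expansive if $\|g(b)\ominus g(a)\|\sqsubseteq\|b\ominus a\|$ for all $a,b$. A function $h:\mathbb{M}^Y\to\mathbb{M}$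 is identified with a function $\mathbb{M}^Y\to\mathbb{M}^{\{*\}}$ for a one-point set $\{*\}$. Approximations: for $a\in\mathbb{M}^Y$ let $[Y]^a=\{y\in Y\mid a(y)\neq0\}$; for $Y'\subseteq Y$ and $\delta\in\mathbb{M}$ let $\delta_{Y'}\in\mathbb{M}^Y$ be $\delta$ on $Y'$ and $0$ elsewhere. For $0\sqsubset\delta\in\mathbb{M}$ and non-expansive $g:\mathbb{M}^Y\to\mathbb{M}^Z$, define $g^{a,\delta}_\#:\mathcal{P}([Y]^a)\to\mathcal{P}([Z]^{g(a)})$ by $g^{a,\delta}_\#(Y')=\{z\in[Z]^{g(a)}\mid g(a)(z)\ominus g(a\ominus\delta_{Y'})(z)\sqsupseteq\delta\}$. It is known that there exists $\iota\sqsupset0$ such that $g^{a,\delta}_\#$ is the same function for all $0\sqsubset\delta\sqsubseteq\iota$; this common function is the $a$-approximation $g^a_\#$. A min-decomposition of $f$ is a map $H_{\min}$ assigning to each $y\in Y$ a finite set $H_{\min}(y)$ of monotone functions $\mathbb{M}^Y\to\mathbb{M}$ such that $f(a)(y)=\min_{h\in H_{\min}(y)}h(a)$ for all $a\in\mathbb{M}^Y$, $y\in Y$. -}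

module Defs where

open import Data.Nat using (ℕ)
open import Data.Fin using (Fin)
open import Data.Fin.Subset using (Subset; _∈_; _⊆_)
open import Data.Bool using (if_then_else_)
open import Data.Vec using (lookup)
open import Data.List using (List; foldr; map)
open import Data.Product using (Σ; ∃; _×_; _,_)
open import Data.Empty using (⊥)
open import Relation.Nullary using (¬_)
open import Relation.Binary.PropositionalEquality using (_≡_)

record MVAlgebra : Set₁ where
  infixl 6 _⊕_
  field
    Carrier : Set
    _⊕_     : Carrier → Carrier → Carrier
    𝟘       : Carrier
    ‾_      : Carrier → Carrier
    ⊕-assoc    : ∀ x y z → (x ⊕ y) ⊕ z ≡ x ⊕ (y ⊕ z)
    ⊕-comm     : ∀ x y → x ⊕ y ≡ y ⊕ x
    ⊕-identity : ∀ x → x ⊕ 𝟘 ≡ x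
    ‾-invol    : ∀ x → ‾ (‾ x) ≡ x
    ⊕-absorb   : ∀ x → x ⊕ (‾ 𝟘) ≡ ‾ 𝟘
    lukasiewicz : ∀ x y → (‾ ((‾ x) ⊕ y)) ⊕ y ≡ (‾ ((‾ y) ⊕ x)) ⊕ x

  _⊖_ : Carrier → Carrier → Carrier
  x ⊖ y = ‾ ((‾ x) ⊕ y)

  _⊑_ : Carrier → Carrier → Set
  x ⊑ y = ∃ λ z → x ⊕ z ≡ y

  _⊏_ : Carrier → Carrier → Set
  x ⊏ y = x ⊑ y × ¬ (x ≡ y)

  𝟙 : Carrier
  𝟙 = ‾ 𝟘

  _⊔_ : Carrier → Carrier → Carrier
  x ⊔ y = (x ⊖ y) ⊕ y

  _⊓_ : Carrier → Carrier → Carrier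
  x ⊓ y = ‾ ((‾ x) ⊔ (‾ y))

  IsUpperBound : (Carrier → Set) → Carrier → Set
  IsUpperBound P u = ∀ x → P x → x ⊑ u

  IsSup : (Carrier → Set) → Carrier → Set
  IsSup P s = IsUpperBound P s × (∀ u → IsUpperBound P u → s ⊑ u)

IsChain : MVAlgebra → Set
IsChain M = ∀ x y → (x ⊑ y) ⊎' (y ⊑ x)
  where
    open MVAlgebra M
    open import Data.Sum renaming (_⊎_ to _⊎'_)

IsComplete : MVAlgebra → Set₁
IsComplete M = (P : Carrier → Set) → ∃ λ s → IsSup P s
  where open MVAlgebra M

record CompleteMVChain : Set₁ where
  field
    mv       : MVAlgebra
    chain    : IsChain mv
    complete : IsComplete mv
  open MVAlgebra mv public

module Ops (M : MVAlgebra) where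
  open MVAlgebra M

  Vec^ : ℕ → Set
  Vec^ n = Fin n → Carrier

  _⊑ᵖ_ : ∀ {n} → Vec^ n → Vec^ n → Set
  a ⊑ᵖ b = ∀ y → a y ⊑ b y

  _⊖ᵖ_ : ∀ {n} → Vec^ n → Vec^ n → Vec^ n
  (a ⊖ᵖ b) y = a y ⊖ b y

  -- ‖a‖ = max_y a(y)   (max of the empty family is 0)
  ‖_‖ : ∀ {n} → Vec^ n → Carrier
  ‖_‖ {ℕ.zero}  a = 𝟘
  ‖_‖ {ℕ.suc n} a = a Fin.zero ⊔ ‖ (λ y → a (Fin.suc y)) ‖

  NonExpansive : ∀ {m k} → (Vec^ m → Vec^ k) → Set
  NonExpansive g = ∀ a b → ‖ g b ⊖ᵖ g a ‖ ⊑ ‖ b ⊖ᵖ a ‖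

  -- h : M^Y → M identified with M^Y → M^{*}
  lift1 : ∀ {m} → (Vec^ m → Carrier) → Vec^ m → Vec^ 1
  lift1 h a _ = h a

  NonExpansive1 : ∀ {m} → (Vec^ m → Carrier) → Set
  NonExpansive1 h = NonExpansive (lift1 h)

  Monotone : ∀ {m} → (Vec^ m → Carrier) → Set
  Monotone h = ∀ a b → a ⊑ᵖ b → h a ⊑ h b

  Supp : ∀ {n} → Vec^ n → Fin n → Set
  Supp a y = ¬ (a y ≡ 𝟘)

  SubsetOfSupp : ∀ {n} → Subset n → Vec^ n → Set
  SubsetOfSupp Y' a = ∀ y → y ∈ Y' → Supp a y

  δ[_]_ : ∀ {n} → Subset n → Carrier → Vec^ n
  (δ[ Y' ] δ) y = if lookup Y' y then δ else 𝟘

  approxδ : ∀ {m k} → (Vec^ m → Vec^ k) → Vec^ m → Carrier → Subset m → Fin k → Set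
  approxδ g a δ Y' z = Supp (g a) z × (δ ⊑ (g a z ⊖ g (a ⊖ᵖ (δ[ Y' ] δ)) z))

  -- g^a_#(Y'): the common value of g^{a,δ}_#(Y') for all sufficiently small δ ⊐ 0
  approx : ∀ {m k} → (Vec^ m → Vec^ k) → Vec^ m → Subset m → Fin k → Set
  approx g a Y' z = ∃ λ ι → (𝟘 ⊏ ι) × (∀ δ → 𝟘 ⊏ δ → δ ⊑ ι → approxδ g a δ Y' z)

  -- min of a finite list (min of the empty list is the top element 1)
  minL : List Carrier → Carrier
  minL = foldr _⊓_ 𝟙

  IsMinDecomposition : ∀ {n} → (Vec^ n → Vec^ n) → (Fin n → List (Vec^ n → Carrier)) → Set
  IsMinDecomposition {n} f H =
    (∀ y h → h ∈L H y → Monotone h) ×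
    (∀ a y → f a y ≡ minL (map (λ h → h a) (H y)))
    where open import Data.List.Membership.Propositional renaming (_∈_ to _∈L_)

-- Non-expansiveness of f is that of min: min_h h b ⊖ min_h h a is bounded by
-- h b ⊖ h a for an h attaining the second minimum.
--
-- For the approximation, write a_δ = a ⊖ δ_{Y'} and m = f(a)(y). If some h that
-- attains the minimum at a drops by at least δ on a_δ, then so does the minimum f.
-- Conversely, let f(a)(y) drop by at least ι on a_ι, and let h attain the minimum
-- at a_ι, with value B ⊑ m ⊖ ι. Non-expansiveness of h gives h(a) ⊑ B ⊕ ι ⊑ m,
-- so h attains the minimum at a as well, and for δ ⊑ ι it gives
-- h(a_δ) ⊑ B ⊕ (ι ⊖ δ) ⊑ (m ⊖ ι) ⊕ (ι ⊖ δ), whence m ⊖ h(a_δ) ⊒ δ: the same ι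
-- witnesses the approximation of h.
{-# OPTIONS --safe #-}
module Submission where

open import Defs
open import Data.Nat using (ℕ)
open import Data.Fin using (Fin; zero; suc)
open import Data.Fin.Subset using (Subset)
open import Data.List using (List; []; _∷_; map)
open import Data.List.Membership.Propositional using (_∈_)
open import Data.List.Relation.Unary.Any using (here; there)
open import Data.Product using (∃; _×_; _,_; proj₂)
open import Data.Sum using (_⊎_; inj₁; inj₂)
open import Data.Empty using (⊥-elim)
open import Data.Bool using (true; false)
open import Data.Vec using (lookup)
open import Function.Bundles using (_⇔_; mk⇔)
open import Relation.Binary.PropositionalEquality
  using (_≡_; refl; sym; trans; cong; cong₂; subst; subst₂; module ≡-Reasoning)

-- Defs declares no fixities for these operators.
module MVNotation (M : MVAlgebra) where
  open MVAlgebra M public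
    renaming (_⊑_ to infix 4 _⊑_; _⊏_ to infix 4 _⊏_; _⊖_ to infixl 7 _⊖_;
              _⊓_ to infixl 7 _⊓_; _⊔_ to infixl 6 _⊔_)

module MVAlgebraProperties (M : MVAlgebra) where
  open MVNotation M
  open Ops M

  ⊑-reflexive : ∀ {x y} → x ≡ y → x ⊑ y
  ⊑-reflexive {x} x≡y = 𝟘 , trans (⊕-identity x) x≡y

  ⊑-refl : ∀ {x} → x ⊑ x
  ⊑-refl = ⊑-reflexive refl

  ⊑-trans : ∀ {x y z} → x ⊑ y → y ⊑ z → x ⊑ z
  ⊑-trans {x} (u , x⊕u≡y) (v , y⊕v≡z) =
    u ⊕ v , trans (sym (⊕-assoc x u v)) (trans (cong (_⊕ v) x⊕u≡y) y⊕v≡z)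

  ⊕-identityˡ : ∀ x → 𝟘 ⊕ x ≡ x
  ⊕-identityˡ x = trans (⊕-comm 𝟘 x) (⊕-identity x)

  𝟘⊑x : ∀ {x} → 𝟘 ⊑ x
  𝟘⊑x {x} = x , ⊕-identityˡ x

  ‾𝟙≡𝟘 : ‾ 𝟙 ≡ 𝟘
  ‾𝟙≡𝟘 = ‾-invol 𝟘

  ‾x⊕x≡𝟙 : ∀ x → ‾ x ⊕ x ≡ 𝟙
  ‾x⊕x≡𝟙 x = begin
    ‾ x ⊕ x                   ≡⟨ cong (λ t → ‾ t ⊕ x) (trans (cong (_⊕ x) ‾𝟙≡𝟘) (⊕-identityˡ x)) ⟨
    ‾ (‾ 𝟙 ⊕ x) ⊕ x           ≡⟨ lukasiewicz x 𝟙 ⟨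
    ‾ (‾ x ⊕ 𝟙) ⊕ 𝟙           ≡⟨ ⊕-absorb (‾ (‾ x ⊕ 𝟙)) ⟩
    𝟙                         ∎
    where open ≡-Reasoning

  x⊑y⇒‾x⊕y≡𝟙 : ∀ {x y} → x ⊑ y → ‾ x ⊕ y ≡ 𝟙
  x⊑y⇒‾x⊕y≡𝟙 {x} {y} (z , x⊕z≡y) = begin
    ‾ x ⊕ y                   ≡⟨ cong (‾ x ⊕_) x⊕z≡y ⟨
    ‾ x ⊕ (x ⊕ z)             ≡⟨ ⊕-assoc (‾ x) x z ⟨
    ‾ x ⊕ x ⊕ z               ≡⟨ cong (_⊕ z) (‾x⊕x≡𝟙 x) ⟩
    𝟙 ⊕ z                     ≡⟨ ⊕-comm 𝟙 z ⟩
    z ⊕ 𝟙                     ≡⟨ ⊕-absorb z ⟩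
    𝟙                         ∎
    where open ≡-Reasoning

  ‾x⊕y≡𝟙⇒x⊑y : ∀ {x y} → ‾ x ⊕ y ≡ 𝟙 → x ⊑ y
  ‾x⊕y≡𝟙⇒x⊑y {x} {y} ‾x⊕y≡𝟙 = ‾ (‾ y ⊕ x) , (begin
    x ⊕ ‾ (‾ y ⊕ x)           ≡⟨ ⊕-comm x _ ⟩
    ‾ (‾ y ⊕ x) ⊕ x           ≡⟨ lukasiewicz x y ⟨
    ‾ (‾ x ⊕ y) ⊕ y           ≡⟨ cong (λ t → ‾ t ⊕ y) ‾x⊕y≡𝟙 ⟩
    ‾ 𝟙 ⊕ y                   ≡⟨ cong (_⊕ y) ‾𝟙≡𝟘 ⟩
    𝟘 ⊕ y                     ≡⟨ ⊕-identityˡ y ⟩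
    y                         ∎)
    where open ≡-Reasoning

  x⊑𝟙 : ∀ {x} → x ⊑ 𝟙
  x⊑𝟙 {x} = ‾x⊕y≡𝟙⇒x⊑y (⊕-absorb (‾ x))

  x⊑y⇒x⊖y≡𝟘 : ∀ {x y} → x ⊑ y → x ⊖ y ≡ 𝟘
  x⊑y⇒x⊖y≡𝟘 x⊑y = trans (cong ‾_ (x⊑y⇒‾x⊕y≡𝟙 x⊑y)) ‾𝟙≡𝟘

  x⊑y⇒x⊔y≡y : ∀ {x y} → x ⊑ y → x ⊔ y ≡ y
  x⊑y⇒x⊔y≡y {y = y} x⊑y = trans (cong (_⊕ y) (x⊑y⇒x⊖y≡𝟘 x⊑y)) (⊕-identityˡ y)

  ⊑-antisym : ∀ {x y} → x ⊑ y → y ⊑ x → x ≡ y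
  ⊑-antisym {x} {y} x⊑y y⊑x =
    trans (sym (x⊑y⇒x⊔y≡y y⊑x)) (trans (lukasiewicz y x) (x⊑y⇒x⊔y≡y x⊑y))

  ‾-antimono : ∀ {x y} → x ⊑ y → ‾ y ⊑ ‾ x
  ‾-antimono {x} {y} x⊑y = ‾x⊕y≡𝟙⇒x⊑y
    (trans (cong (_⊕ ‾ x) (‾-invol y)) (trans (⊕-comm y (‾ x)) (x⊑y⇒‾x⊕y≡𝟙 x⊑y)))

  ⊕-monoˡ-⊑ : ∀ {x y} z → x ⊑ y → x ⊕ z ⊑ y ⊕ z
  ⊕-monoˡ-⊑ {x} z (w , x⊕w≡y) = w , (begin
    x ⊕ z ⊕ w                 ≡⟨ ⊕-assoc x z w ⟩
    x ⊕ (z ⊕ w)               ≡⟨ cong (x ⊕_) (⊕-comm z w) ⟩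
    x ⊕ (w ⊕ z)               ≡⟨ ⊕-assoc x w z ⟨
    x ⊕ w ⊕ z                 ≡⟨ cong (_⊕ z) x⊕w≡y ⟩
    _                         ∎)
    where open ≡-Reasoning

  ⊕-monoʳ-⊑ : ∀ {x y} z → x ⊑ y → z ⊕ x ⊑ z ⊕ y
  ⊕-monoʳ-⊑ {x} {y} z x⊑y = subst₂ _⊑_ (⊕-comm x z) (⊕-comm y z) (⊕-monoˡ-⊑ z x⊑y)

  ⊖-monoˡ-⊑ : ∀ {x y} z → x ⊑ y → x ⊖ z ⊑ y ⊖ z
  ⊖-monoˡ-⊑ z x⊑y = ‾-antimono (⊕-monoˡ-⊑ z (‾-antimono x⊑y))

  ⊖-antimonoʳ-⊑ : ∀ x {y z} → y ⊑ z → x ⊖ z ⊑ x ⊖ y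
  ⊖-antimonoʳ-⊑ x y⊑z = ‾-antimono (⊕-monoʳ-⊑ (‾ x) y⊑z)

  x⊑y⊕z⇒x⊖y⊑z : ∀ {x y z} → x ⊑ y ⊕ z → x ⊖ y ⊑ z
  x⊑y⊕z⇒x⊖y⊑z {x} {y} {z} x⊑y⊕z = ‾x⊕y≡𝟙⇒x⊑y
    (trans (cong (_⊕ z) (‾-invol (‾ x ⊕ y))) (trans (⊕-assoc (‾ x) y z) (x⊑y⇒‾x⊕y≡𝟙 x⊑y⊕z)))

  x⊖y⊑z⇒x⊑y⊕z : ∀ {x y z} → x ⊖ y ⊑ z → x ⊑ y ⊕ z
  x⊖y⊑z⇒x⊑y⊕z {x} {y} {z} x⊖y⊑z = ‾x⊕y≡𝟙⇒x⊑y
    (trans (sym (⊕-assoc (‾ x) y z))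
      (trans (cong (_⊕ z) (sym (‾-invol (‾ x ⊕ y)))) (x⊑y⇒‾x⊕y≡𝟙 x⊖y⊑z)))

  x⊑x⊖y⊕y : ∀ x y → x ⊑ x ⊖ y ⊕ y
  x⊑x⊖y⊕y x y = subst (x ⊑_) (lukasiewicz y x) (y ⊖ x , ⊕-comm x _)

  y⊑x⇒x⊖y⊕y≡x : ∀ {x y} → y ⊑ x → x ⊖ y ⊕ y ≡ x
  y⊑x⇒x⊖y⊕y≡x {x} {y} y⊑x = trans (lukasiewicz x y) (x⊑y⇒x⊔y≡y y⊑x)

  x⊖y⊑x : ∀ x y → x ⊖ y ⊑ x
  x⊖y⊑x x y = x⊑y⊕z⇒x⊖y⊑z (y , ⊕-comm x y)

  x⊖𝟘≡x : ∀ x → x ⊖ 𝟘 ≡ x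
  x⊖𝟘≡x x = trans (cong ‾_ (⊕-identity (‾ x))) (‾-invol x)

  x⊖x≡𝟘 : ∀ x → x ⊖ x ≡ 𝟘
  x⊖x≡𝟘 x = x⊑y⇒x⊖y≡𝟘 ⊑-refl

  x⊖𝟙≡𝟘 : ∀ x → x ⊖ 𝟙 ≡ 𝟘
  x⊖𝟙≡𝟘 x = x⊑y⇒x⊖y≡𝟘 x⊑𝟙

  x⊑y⇒x⊓y≡x : ∀ {x y} → x ⊑ y → x ⊓ y ≡ x
  x⊑y⇒x⊓y≡x {x} {y} x⊑y =
    trans (cong ‾_ (trans (lukasiewicz (‾ x) (‾ y)) (x⊑y⇒x⊔y≡y (‾-antimono x⊑y)))) (‾-invol x)

  y⊑x⇒x⊓y≡y : ∀ {x y} → y ⊑ x → x ⊓ y ≡ y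
  y⊑x⇒x⊓y≡y {y = y} y⊑x = trans (cong ‾_ (x⊑y⇒x⊔y≡y (‾-antimono y⊑x))) (‾-invol y)

  x⊖[x⊖y]≡x⊓y : ∀ x y → x ⊖ (x ⊖ y) ≡ x ⊓ y
  x⊖[x⊖y]≡x⊓y x y = cong ‾_ (begin
    ‾ x ⊕ ‾ (‾ x ⊕ y)         ≡⟨ ⊕-comm (‾ x) _ ⟩
    ‾ (‾ x ⊕ y) ⊕ ‾ x         ≡⟨ cong (λ t → ‾ t ⊕ ‾ x) (⊕-comm (‾ x) y) ⟩
    ‾ (y ⊕ ‾ x) ⊕ ‾ x         ≡⟨ cong (λ t → ‾ (t ⊕ ‾ x) ⊕ ‾ x) (‾-invol y) ⟨
    ‾ (‾ (‾ y) ⊕ ‾ x) ⊕ ‾ x   ≡⟨ lukasiewicz (‾ y) (‾ x) ⟩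
    ‾ x ⊔ ‾ y                 ∎)
    where open ≡-Reasoning

  y⊑x⇒x⊖[x⊖y]≡y : ∀ {x y} → y ⊑ x → x ⊖ (x ⊖ y) ≡ y
  y⊑x⇒x⊖[x⊖y]≡y {x} {y} y⊑x = trans (x⊖[x⊖y]≡x⊓y x y) (y⊑x⇒x⊓y≡y y⊑x)

  x⊖[x⊖y]⊑y : ∀ x y → x ⊖ (x ⊖ y) ⊑ y
  x⊖[x⊖y]⊑y x y = x⊑y⊕z⇒x⊖y⊑z (x⊑x⊖y⊕y x y)

  x⊖[y⊕z]≡x⊖y⊖z : ∀ x y z → x ⊖ (y ⊕ z) ≡ (x ⊖ y) ⊖ z
  x⊖[y⊕z]≡x⊖y⊖z x y z =
    cong ‾_ (trans (sym (⊕-assoc (‾ x) y z)) (cong (_⊕ z) (sym (‾-invol (‾ x ⊕ y)))))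

  ⊖-triangle : ∀ x y z → x ⊖ y ⊑ (x ⊖ z) ⊕ (z ⊖ y)
  ⊖-triangle x y z = x⊑y⊕z⇒x⊖y⊑z (⊑-trans (x⊑x⊖y⊕y x z)
    (⊑-trans (⊕-monoʳ-⊑ (x ⊖ z) (x⊑x⊖y⊕y z y)) (⊑-reflexive regroup)))
    where
    regroup : (x ⊖ z) ⊕ ((z ⊖ y) ⊕ y) ≡ y ⊕ ((x ⊖ z) ⊕ (z ⊖ y))
    regroup = trans (sym (⊕-assoc (x ⊖ z) (z ⊖ y) y)) (⊕-comm _ y)

  nonExpansive1⇒⊖⊑‖⊖‖ : ∀ {n} {h : Vec^ n → Carrier} → NonExpansive1 h →
    ∀ a b → h b ⊖ h a ⊑ ‖ b ⊖ᵖ a ‖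
  nonExpansive1⇒⊖⊑‖⊖‖ {h = h} h-ne a b =
    subst (_⊑ ‖ b ⊖ᵖ a ‖) (trans (⊕-identity _) (x⊖𝟘≡x (h b ⊖ h a))) (h-ne a b)

module MVChainProperties (M : MVAlgebra) (chain : IsChain M) where
  open MVNotation M
  open Ops M
  open MVAlgebraProperties M

  ⊔-lub : ∀ {x y z} → x ⊑ z → y ⊑ z → x ⊔ y ⊑ z
  ⊔-lub {x} {y} x⊑z y⊑z with chain x y
  ... | inj₁ x⊑y = subst (_⊑ _) (sym (x⊑y⇒x⊔y≡y x⊑y)) y⊑z
  ... | inj₂ y⊑x = subst (_⊑ _) (sym (y⊑x⇒x⊖y⊕y≡x y⊑x)) x⊑z

  x⊓y⊑x : ∀ x y → x ⊓ y ⊑ x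
  x⊓y⊑x x y with chain x y
  ... | inj₁ x⊑y = ⊑-reflexive (x⊑y⇒x⊓y≡x x⊑y)
  ... | inj₂ y⊑x = subst (_⊑ x) (sym (y⊑x⇒x⊓y≡y y⊑x)) y⊑x

  x⊓y⊑y : ∀ x y → x ⊓ y ⊑ y
  x⊓y⊑y x y with chain x y
  ... | inj₁ x⊑y = subst (_⊑ y) (sym (x⊑y⇒x⊓y≡x x⊑y)) x⊑y
  ... | inj₂ y⊑x = ⊑-reflexive (y⊑x⇒x⊓y≡y y⊑x)

  ⊖-swap : ∀ {x y z} → 𝟘 ⊏ z → z ⊑ x ⊖ y → y ⊑ x ⊖ z
  ⊖-swap {x} {y} (_ , 𝟘≢z) z⊑x⊖y with chain y x
  ... | inj₁ y⊑x = subst (_⊑ x ⊖ _) (y⊑x⇒x⊖[x⊖y]≡y y⊑x) (⊖-antimonoʳ-⊑ x z⊑x⊖y)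
  ... | inj₂ x⊑y = ⊥-elim (𝟘≢z (⊑-antisym 𝟘⊑x (subst (_ ⊑_) (x⊑y⇒x⊖y≡𝟘 x⊑y) z⊑x⊖y)))

  minL-⊑ : ∀ {A : Set} (g : A → Carrier) (L : List A) {h} → h ∈ L → minL (map g L) ⊑ g h
  minL-⊑ g (_ ∷ L) (here refl) = x⊓y⊑x _ _
  minL-⊑ g (_ ∷ L) (there h∈L) = ⊑-trans (x⊓y⊑y _ _) (minL-⊑ g L h∈L)

  minL-attained : ∀ {A : Set} (g : A → Carrier) (L : List A) →
    minL (map g L) ≡ 𝟙 ⊎ ∃ λ h → h ∈ L × minL (map g L) ≡ g h
  minL-attained g [] = inj₁ refl
  minL-attained g (x ∷ L) with chain (g x) (minL (map g L))
  ... | inj₁ gx⊑min = inj₂ (x , here refl , x⊑y⇒x⊓y≡x gx⊑min)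
  ... | inj₂ min⊑gx with minL-attained g L
  ...   | inj₁ min≡𝟙 = inj₁ (trans (y⊑x⇒x⊓y≡y min⊑gx) min≡𝟙)
  ...   | inj₂ (h , h∈L , min≡gh) = inj₂ (h , there h∈L , trans (y⊑x⇒x⊓y≡y min⊑gx) min≡gh)

  minL-⊖-minL : ∀ {A : Set} (g₁ g₂ : A → Carrier) (L : List A) {z} →
    (∀ h → h ∈ L → g₁ h ⊖ g₂ h ⊑ z) → minL (map g₁ L) ⊖ minL (map g₂ L) ⊑ z
  minL-⊖-minL g₁ g₂ L {z} bound with minL-attained g₂ L
  ... | inj₁ min≡𝟙 =
    subst (λ t → minL (map g₁ L) ⊖ t ⊑ z) (sym min≡𝟙) (subst (_⊑ z) (sym (x⊖𝟙≡𝟘 _)) 𝟘⊑x)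
  ... | inj₂ (h , h∈L , min≡g₂h) =
    subst (λ t → minL (map g₁ L) ⊖ t ⊑ z) (sym min≡g₂h)
      (⊑-trans (⊖-monoˡ-⊑ (g₂ h) (minL-⊑ g₁ L h∈L)) (bound h h∈L))

  ‖‖-lub : ∀ {n} (v : Vec^ n) {z} → (∀ i → v i ⊑ z) → ‖ v ‖ ⊑ z
  ‖‖-lub {ℕ.zero} v v⊑z = 𝟘⊑x
  ‖‖-lub {ℕ.suc n} v v⊑z = ⊔-lub (v⊑z zero) (‖‖-lub (λ i → v (suc i)) (λ i → v⊑z (suc i)))

  ‖a⊖[a⊖δ]‖⊑δ : ∀ {n} (a : Vec^ n) (Y' : Subset n) δ → ‖ a ⊖ᵖ (a ⊖ᵖ (δ[ Y' ] δ)) ‖ ⊑ δ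
  ‖a⊖[a⊖δ]‖⊑δ a Y' δ = ‖‖-lub _ pointwise
    where
    pointwise : ∀ y → a y ⊖ (a y ⊖ (δ[ Y' ] δ) y) ⊑ δ
    pointwise y with lookup Y' y
    ... | true  = x⊖[x⊖y]⊑y (a y) δ
    ... | false = ⊑-trans (x⊖[x⊖y]⊑y (a y) 𝟘) 𝟘⊑x

  ‖[a⊖δ]⊖[a⊖ι]‖⊑ι⊖δ : ∀ {n} (a : Vec^ n) (Y' : Subset n) δ ι →
    ‖ (a ⊖ᵖ (δ[ Y' ] δ)) ⊖ᵖ (a ⊖ᵖ (δ[ Y' ] ι)) ‖ ⊑ ι ⊖ δ
  ‖[a⊖δ]⊖[a⊖ι]‖⊑ι⊖δ a Y' δ ι = ‖‖-lub _ pointwise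
    where
    pointwise : ∀ y → (a y ⊖ (δ[ Y' ] δ) y) ⊖ (a y ⊖ (δ[ Y' ] ι) y) ⊑ ι ⊖ δ
    pointwise y with lookup Y' y
    ... | true  = x⊑y⊕z⇒x⊖y⊑z (⊖-triangle (a y) δ ι)
    ... | false = subst (_⊑ ι ⊖ δ) (sym (x⊖x≡𝟘 (a y ⊖ 𝟘))) 𝟘⊑x

module MinDecompositions (M : MVAlgebra) (chain : IsChain M) {n : ℕ} where
  open MVNotation M
  open Ops M
  open MVAlgebraProperties M
  open MVChainProperties M chain

  module Properties (f : Vec^ n → Vec^ n) (H : Fin n → List (Vec^ n → Carrier))
           (f≡minH : ∀ a y → f a y ≡ minL (map (λ h → h a) (H y)))
           (H-nonExpansive : ∀ y h → h ∈ H y → NonExpansive1 h) where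

    f⊑h : ∀ {y h} → h ∈ H y → ∀ a → f a y ⊑ h a
    f⊑h {y} h∈H a = subst (_⊑ _) (sym (f≡minH a y)) (minL-⊑ (λ h → h a) (H y) h∈H)

    h⊖h⊑‖⊖‖ : ∀ {y h} → h ∈ H y → ∀ a b → h b ⊖ h a ⊑ ‖ b ⊖ᵖ a ‖
    h⊖h⊑‖⊖‖ {y} {h} h∈H = nonExpansive1⇒⊖⊑‖⊖‖ (H-nonExpansive y h h∈H)

    f-nonExpansive : NonExpansive f
    f-nonExpansive a b = ‖‖-lub (f b ⊖ᵖ f a) λ y →
      subst (_⊑ ‖ b ⊖ᵖ a ‖) (sym (cong₂ _⊖_ (f≡minH b y) (f≡minH a y)))
        (minL-⊖-minL (λ h → h b) (λ h → h a) (H y) (λ h h∈H → h⊖h⊑‖⊖‖ h∈H a b))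

    Minimises : Vec^ n → Fin n → (Vec^ n → Carrier) → Set
    Minimises a y h = h a ≡ minL (map (λ h′ → h′ a) (H y))

    approx-minimiser⇒approx-f : ∀ a Y' y →
      Supp (f a) y × (∃ λ h → h ∈ H y × Minimises a y h × ∃ λ (z : Fin 1) → approx (lift1 h) a Y' z) →
      approx f a Y' y
    approx-minimiser⇒approx-f a Y' y (fa≢𝟘 , h , h∈H , h-min , _ , ι , 𝟘⊏ι , h-approx) =
      ι , 𝟘⊏ι , λ δ 𝟘⊏δ δ⊑ι → fa≢𝟘 , ⊑-trans (proj₂ (h-approx δ 𝟘⊏δ δ⊑ι)) (h-gap⊑f-gap δ)
      where
      h-gap⊑f-gap : ∀ δ → h a ⊖ h (a ⊖ᵖ (δ[ Y' ] δ)) ⊑ f a y ⊖ f (a ⊖ᵖ (δ[ Y' ] δ)) y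
      h-gap⊑f-gap δ = subst (λ t → h a ⊖ _ ⊑ t ⊖ _) (trans h-min (sym (f≡minH a y)))
        (⊖-antimonoʳ-⊑ (h a) (f⊑h h∈H (a ⊖ᵖ (δ[ Y' ] δ))))

    module _ {a : Vec^ n} (Y' : Subset n) {y : Fin n} {h : Vec^ n → Carrier} (h∈H : h ∈ H y)
             {ι : Carrier} (𝟘⊏ι : 𝟘 ⊏ ι) (ι⊑gap : ι ⊑ f a y ⊖ h (a ⊖ᵖ (δ[ Y' ] ι))) where
      private
        m B : Carrier
        m = f a y
        B = h (a ⊖ᵖ (δ[ Y' ] ι))

        B⊑m⊖ι : B ⊑ m ⊖ ι
        B⊑m⊖ι = ⊖-swap 𝟘⊏ι ι⊑gap

        ι⊑m : ι ⊑ m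
        ι⊑m = ⊑-trans ι⊑gap (x⊖y⊑x m B)

        h⊑m⊖ι⊕ : ∀ {b d} → h b ⊖ B ⊑ d → h b ⊑ m ⊖ ι ⊕ d
        h⊑m⊖ι⊕ h-gap = ⊑-trans (x⊖y⊑z⇒x⊑y⊕z h-gap) (⊕-monoˡ-⊑ _ B⊑m⊖ι)

      h-attains-f : h a ≡ m
      h-attains-f = ⊑-antisym ha⊑m (f⊑h h∈H a)
        where
        ha⊑m : h a ⊑ m
        ha⊑m = ⊑-trans (⊑-trans (h⊑m⊖ι⊕ (h⊖h⊑‖⊖‖ h∈H _ a)) (⊕-monoʳ-⊑ (m ⊖ ι) (‖a⊖[a⊖δ]‖⊑δ a Y' ι)))
                 (⊑-reflexive (y⊑x⇒x⊖y⊕y≡x ι⊑m))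

      h-gap-from-f-gap : ∀ δ → δ ⊑ ι → δ ⊑ h a ⊖ h (a ⊖ᵖ (δ[ Y' ] δ))
      h-gap-from-f-gap δ δ⊑ι = subst (λ t → δ ⊑ t ⊖ h (a ⊖ᵖ (δ[ Y' ] δ))) (sym h-attains-f)
        (subst (_⊑ m ⊖ h (a ⊖ᵖ (δ[ Y' ] δ))) m⊖[[m⊖ι]⊕[ι⊖δ]]≡δ (⊖-antimonoʳ-⊑ m hδ⊑))
        where
        hδ⊑ : h (a ⊖ᵖ (δ[ Y' ] δ)) ⊑ (m ⊖ ι) ⊕ (ι ⊖ δ)
        hδ⊑ = ⊑-trans (h⊑m⊖ι⊕ (h⊖h⊑‖⊖‖ h∈H _ _)) (⊕-monoʳ-⊑ (m ⊖ ι) (‖[a⊖δ]⊖[a⊖ι]‖⊑ι⊖δ a Y' δ ι))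
        m⊖[[m⊖ι]⊕[ι⊖δ]]≡δ : m ⊖ ((m ⊖ ι) ⊕ (ι ⊖ δ)) ≡ δ
        m⊖[[m⊖ι]⊕[ι⊖δ]]≡δ = begin
          m ⊖ ((m ⊖ ι) ⊕ (ι ⊖ δ))   ≡⟨ x⊖[y⊕z]≡x⊖y⊖z m (m ⊖ ι) (ι ⊖ δ) ⟩
          (m ⊖ (m ⊖ ι)) ⊖ (ι ⊖ δ)   ≡⟨ cong (_⊖ (ι ⊖ δ)) (y⊑x⇒x⊖[x⊖y]≡y ι⊑m) ⟩
          ι ⊖ (ι ⊖ δ)               ≡⟨ y⊑x⇒x⊖[x⊖y]≡y δ⊑ι ⟩
          δ                         ∎
          where open ≡-Reasoning

    approx-f⇒approx-minimiser : ∀ a Y' y → approx f a Y' y →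
      Supp (f a) y × (∃ λ h → h ∈ H y × Minimises a y h × ∃ λ (z : Fin 1) → approx (lift1 h) a Y' z)
    approx-f⇒approx-minimiser a Y' y (ι , 𝟘⊏ι , f-approx) with f-approx ι 𝟘⊏ι ⊑-refl
    ... | fa≢𝟘 , ι⊑f-gap with minL-attained (λ h → h (a ⊖ᵖ (δ[ Y' ] ι))) (H y)
    ... | inj₁ min≡𝟙 = ⊥-elim (proj₂ 𝟘⊏ι (⊑-antisym 𝟘⊑x
          (subst (ι ⊑_) (trans (cong (f a y ⊖_) (trans (f≡minH _ y) min≡𝟙)) (x⊖𝟙≡𝟘 _)) ι⊑f-gap)))
    ... | inj₂ (h , h∈H , min≡h) =
      fa≢𝟘 , h , h∈H , trans (h-attains-f Y' h∈H 𝟘⊏ι ι⊑h-gap) (f≡minH a y) ,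
      zero , ι , 𝟘⊏ι , λ δ _ δ⊑ι →
        (λ ha≡𝟘 → fa≢𝟘 (trans (sym (h-attains-f Y' h∈H 𝟘⊏ι ι⊑h-gap)) ha≡𝟘)) ,
        h-gap-from-f-gap Y' h∈H 𝟘⊏ι ι⊑h-gap δ δ⊑ι
      where
      ι⊑h-gap : ι ⊑ f a y ⊖ h (a ⊖ᵖ (δ[ Y' ] ι))
      ι⊑h-gap = subst (λ t → ι ⊑ f a y ⊖ t) (trans (f≡minH _ y) min≡h) ι⊑f-gap

mainTheorem10 : (M : CompleteMVChain) (n : ℕ) →
    let open CompleteMVChain M in
    let open Ops mv in
    (f : Vec^ n → Vec^ n) (H : Fin n → List (Vec^ n → Carrier)) →
    IsMinDecomposition f H →
    (∀ y h → h ∈ H y → NonExpansive1 h) →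
    NonExpansive f ×
    (∀ (a : Vec^ n) (Y' : Subset n) → SubsetOfSupp Y' a → ∀ (y : Fin n) →
      approx f a Y' y ⇔
      (Supp (f a) y ×
        (∃ λ h → h ∈ H y ×
          (h a ≡ minL (map (λ h' → h' a) (H y))) ×
          (∃ λ (z : Fin 1) → approx (lift1 h) a Y' z))))
mainTheorem10 M n f H (_ , f≡minH) H-nonExpansive =
  f-nonExpansive , λ a Y' _ y →
    mk⇔ (approx-f⇒approx-minimiser a Y' y) (approx-minimiser⇒approx-f a Y' y)
  where
  open CompleteMVChain M
  open MinDecompositions mv chain
  open Properties f H f≡minH H-nonExpansive
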